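{- Suppose that for every $n\ge 2$, every matching $M$ of $Q_n$ and every two vertices $u,v\in V(Q_n)$ of opposite parity with $u$ not covered by $M$, there exists a Hamilton path of $Q_n$ between $u$ and $v$ containing all edges of $M$. Then for every $n\ge 2$, every matching of $Q_n$ can be extended to a Hamilton cycle of $Q_n$.
   Context: $Q_n$ has vertex set $\{0,1\}^n$, two vertices adjacent iff they differ in exactly one coordinate; the parity of a vertex is the parity of its number of ones. A vertex is covered by a matching if it is an endpoint of one of its edges. A matching is extended to a Hamilton cycle if some Hamilton cycle contains all of its edges. -}

module Defs where

open import Data.Bool using (Bool; true; false; _xor_; if_then_else_)
open import Data.Nat using (ℕ; zero; suc; _+_; _%_)
open import Data.Vec using (Vec; []; _∷_)
open import Data.List using (List; []; _∷_; _++_; [_])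
open import Data.Product using (Σ; _×_; _,_; ∃₂; proj₁; proj₂)
open import Data.Sum using (_⊎_)
open import Relation.Binary.PropositionalEquality using (_≡_; _≢_)
open import Data.List.Relation.Unary.Unique.Propositional using (Unique)
open import Data.List.Relation.Unary.Linked using (Linked)
open import Data.List.Relation.Unary.All using (All)
open import Data.List.Membership.Propositional using (_∈_)

Vertex : ℕ → Set
Vertex n = Vec Bool n

dist : ∀ {n} → Vertex n → Vertex n → ℕ
dist [] [] = 0
dist (a ∷ x) (b ∷ y) = (if a xor b then 1 else 0) + dist x y

Adjacent : ∀ {n} → Vertex n → Vertex n → Set
Adjacent x y = dist x y ≡ 1

weight : ∀ {n} → Vertex n → ℕ
weight [] = 0
weight (a ∷ x) = (if a then 1 else 0) + weight x

parity : ∀ {n} → Vertex n → ℕ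
parity v = weight v % 2

OppositeParity : ∀ {n} → Vertex n → Vertex n → Set
OppositeParity u v = parity u ≢ parity v

EdgeList : ℕ → Set
EdgeList n = List (Vertex n × Vertex n)

endpoints : ∀ {n} → EdgeList n → List (Vertex n)
endpoints [] = []
endpoints ((x , y) ∷ es) = x ∷ y ∷ endpoints es

-- a matching: every listed pair is an edge of Q_n and no vertex is an
-- endpoint of two listed edges (so in particular edges are distinct)
IsMatching : ∀ {n} → EdgeList n → Set
IsMatching M = All (λ e → Adjacent (proj₁ e) (proj₂ e)) M × Unique (endpoints M)

Covered : ∀ {n} → Vertex n → EdgeList n → Set
Covered v M = v ∈ endpoints M

Consecutive : ∀ {A : Set} → List A → A → A → Set
Consecutive p x y = ∃₂ λ as bs → p ≡ as ++ (x ∷ y ∷ bs)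

EdgeOfWalk : ∀ {A : Set} → List A → A → A → Set
EdgeOfWalk p x y = Consecutive p x y ⊎ Consecutive p y x

ContainsEdges : ∀ {n} → List (Vertex n) → EdgeList n → Set
ContainsEdges p M = All (λ e → EdgeOfWalk p (proj₁ e) (proj₂ e)) M

IsHamPath : ∀ {n} → List (Vertex n) → Set
IsHamPath {n} p = Unique p × (∀ (v : Vertex n) → v ∈ p) × Linked Adjacent p

close : ∀ {A : Set} → List A → List A
close [] = []
close (w ∷ ws) = w ∷ ws ++ [ w ]

-- Hamilton cycle given by its cyclic vertex sequence c; its edges are the
-- consecutive pairs of close c
IsHamCycle : ∀ {n} → List (Vertex n) → Set
IsHamCycle {n} c = Unique c × (∀ (v : Vertex n) → v ∈ c) × Linked Adjacent (close c)

ExtendsToHamCycle : ∀ {n} → EdgeList n → Set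
ExtendsToHamCycle {n} M = Σ (List (Vertex n)) λ c → IsHamCycle c × ContainsEdges (close c) M

{-# OPTIONS --safe #-}
-- Pick an edge ab of M (any edge of Q_n if M is empty). Adjacent vertices have
-- opposite parity and a is not covered by the rest of M, so the hypothesis gives
-- a Hamilton path from a to b through the rest of M; the edge ba closes it into
-- a Hamilton cycle through all of M.
module Submission where

open import Defs
open import Data.Nat using (ℕ; _≤_; zero; suc; _%_)
open import Data.Nat.Properties using (suc-injective)
open import Data.List using (List; head; last; []; _∷_; _++_; [_]; _∷ʳ_)
open import Data.List.Properties using (++-assoc)
open import Data.List.Relation.Unary.All as All using (_∷_)
open import Data.List.Relation.Unary.All.Properties using (All¬⇒¬Any)
open import Data.List.Relation.Unary.AllPairs using (_∷_)
open import Data.List.Relation.Unary.Linked using ([-])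
open import Data.List.Relation.Unary.Linked.Properties using (++⁺)
open import Data.Maybe using (just)
open import Data.Maybe.Relation.Binary.Connected using (Connected; just)
open import Data.Product using (Σ; _×_; _,_)
open import Data.Sum as Sum using (_⊎_; inj₁; inj₂)
open import Data.Bool using (true; false)
open import Data.Vec using (replicate) renaming ([] to []ᵥ; _∷_ to _∷ᵥ_)
open import Function using (_∘_)
open import Relation.Nullary using (¬_)
open import Relation.Binary.PropositionalEquality using (_≡_; _≢_; refl; sym; cong; subst; module ≡-Reasoning)

dist-refl : ∀ {n} (x : Vertex n) → dist x x ≡ 0
dist-refl []ᵥ          = refl
dist-refl (false ∷ᵥ x) = dist-refl x
dist-refl (true ∷ᵥ x)  = dist-refl x

dist-sym : ∀ {n} (x y : Vertex n) → dist x y ≡ dist y x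
dist-sym []ᵥ          []ᵥ          = refl
dist-sym (false ∷ᵥ x) (false ∷ᵥ y) = dist-sym x y
dist-sym (false ∷ᵥ x) (true ∷ᵥ y)  = cong suc (dist-sym x y)
dist-sym (true ∷ᵥ x)  (false ∷ᵥ y) = cong suc (dist-sym x y)
dist-sym (true ∷ᵥ x)  (true ∷ᵥ y)  = dist-sym x y

dist≡0⇒≡ : ∀ {n} (x y : Vertex n) → dist x y ≡ 0 → x ≡ y
dist≡0⇒≡ []ᵥ          []ᵥ          _ = refl
dist≡0⇒≡ (false ∷ᵥ x) (false ∷ᵥ y) d = cong (false ∷ᵥ_) (dist≡0⇒≡ x y d)
dist≡0⇒≡ (true ∷ᵥ x)  (true ∷ᵥ y)  d = cong (true ∷ᵥ_) (dist≡0⇒≡ x y d)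

Adjacent-sym : ∀ {n} (x y : Vertex n) → Adjacent x y → Adjacent y x
Adjacent-sym x y xy = subst (_≡ 1) (dist-sym x y) xy

adjacent-weight : ∀ {n} (x y : Vertex n) → Adjacent x y →
                  weight y ≡ suc (weight x) ⊎ weight x ≡ suc (weight y)
adjacent-weight []ᵥ          []ᵥ          ()
adjacent-weight (false ∷ᵥ x) (false ∷ᵥ y) xy = adjacent-weight x y xy
adjacent-weight (true ∷ᵥ x)  (true ∷ᵥ y)  xy = Sum.map (cong suc) (cong suc) (adjacent-weight x y xy)
adjacent-weight (false ∷ᵥ x) (true ∷ᵥ y)  xy = inj₁ (cong (suc ∘ weight) (sym (dist≡0⇒≡ x y (suc-injective xy))))
adjacent-weight (true ∷ᵥ x)  (false ∷ᵥ y) xy = inj₂ (cong (suc ∘ weight) (dist≡0⇒≡ x y (suc-injective xy)))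

suc-%2≢ : ∀ m → suc m % 2 ≢ m % 2
suc-%2≢ zero          ()
suc-%2≢ (suc zero)    ()
suc-%2≢ (suc (suc m)) = suc-%2≢ m

adjacent⇒oppositeParity : ∀ {n} (x y : Vertex n) → Adjacent x y → OppositeParity x y
adjacent⇒oppositeParity x y xy with adjacent-weight x y xy
... | inj₁ wy≡1+wx = λ px≡py → suc-%2≢ (weight x) (subst (λ w → w % 2 ≡ _) wy≡1+wx (sym px≡py))
... | inj₂ wx≡1+wy = λ px≡py → suc-%2≢ (weight y) (subst (λ w → w % 2 ≡ _) wx≡1+wy px≡py)

zero-adjacent-e₁ : ∀ n → Adjacent (replicate (suc n) false) (true ∷ᵥ replicate n false)
zero-adjacent-e₁ n = cong suc (dist-refl (replicate n false))

matching-uncons : ∀ {n} {a b : Vertex n} {M : EdgeList n} → IsMatching ((a , b) ∷ M) →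
                  Adjacent a b × ¬ Covered a M × IsMatching M
matching-uncons (ab ∷ adj , (_ ∷ a∉M) ∷ _ ∷ unique) = ab , All¬⇒¬Any a∉M , (adj , unique)

module _ {A : Set} where

  Consecutive-++⁺ˡ : ∀ {p : List A} zs {x y : A} → Consecutive p x y → Consecutive (p ++ zs) x y
  Consecutive-++⁺ˡ zs {x} {y} (as , bs , refl) = as , bs ++ zs , ++-assoc as (x ∷ y ∷ bs) zs

  EdgeOfWalk-++⁺ˡ : ∀ {p : List A} zs {x y : A} → EdgeOfWalk p x y → EdgeOfWalk (p ++ zs) x y
  EdgeOfWalk-++⁺ˡ zs = Sum.map (Consecutive-++⁺ˡ zs) (Consecutive-++⁺ˡ zs)

  last≡just⇒∷ʳ : ∀ (xs : List A) {b : A} → last xs ≡ just b → Σ (List A) λ ys → xs ≡ ys ∷ʳ b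
  last≡just⇒∷ʳ (x ∷ [])     refl = [] , refl
  last≡just⇒∷ʳ (x ∷ y ∷ xs) l    with ys , eq ← last≡just⇒∷ʳ (y ∷ xs) l = x ∷ ys , cong (x ∷_) eq

  close-consecutive : ∀ (xs : List A) {a b : A} → head xs ≡ just a → last xs ≡ just b →
                      Consecutive (close xs) b a
  close-consecutive (a ∷ ws) {b = b} refl l with last≡just⇒∷ʳ (a ∷ ws) l
  ... | ys , eq = ys , [] , (begin
      (a ∷ ws) ++ [ a ]   ≡⟨ cong (_++ [ a ]) eq ⟩
      (ys ∷ʳ b) ++ [ a ]  ≡⟨ ++-assoc ys [ b ] [ a ] ⟩
      ys ++ b ∷ a ∷ []    ∎)
    where open ≡-Reasoning

ContainsEdges-++⁺ˡ : ∀ {n} {p : List (Vertex n)} zs {M : EdgeList n} →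
                     ContainsEdges p M → ContainsEdges (p ++ zs) M
ContainsEdges-++⁺ˡ zs = All.map (EdgeOfWalk-++⁺ˡ zs)

hamPath-close : ∀ {n} {p : List (Vertex n)} {a b : Vertex n} → IsHamPath p →
                head p ≡ just a → last p ≡ just b → Adjacent b a → IsHamCycle p
hamPath-close {p = a ∷ ws} (unique , complete , linked) refl l ba =
  unique , complete , ++⁺ linked (subst (λ m → Connected Adjacent m (just a)) (sym l) (just ba)) [-]

hamPath-extends : ∀ {n} {p : List (Vertex n)} {a b : Vertex n} {M : EdgeList n} → IsHamPath p →
                  head p ≡ just a → last p ≡ just b → Adjacent a b → ContainsEdges p M →
                  ExtendsToHamCycle ((a , b) ∷ M)
hamPath-extends {p = a ∷ ws} {b = b} ham refl l ab contains =
  a ∷ ws , hamPath-close ham refl l (Adjacent-sym a b ab) ,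
  inj₂ (close-consecutive (a ∷ ws) refl l) ∷ ContainsEdges-++⁺ˡ [ a ] contains

ExtendsToHamCycle-tail : ∀ {n} {e} {M : EdgeList n} → ExtendsToHamCycle (e ∷ M) → ExtendsToHamCycle M
ExtendsToHamCycle-tail (c , cycle , _ ∷ contains) = c , cycle , contains

HamPathsThroughMatchings : ℕ → Set
HamPathsThroughMatchings n =
  (M : EdgeList n) → IsMatching M → (u v : Vertex n) → OppositeParity u v → ¬ Covered u M →
  Σ (List (Vertex n)) (λ p → IsHamPath p × head p ≡ just u × last p ≡ just v × ContainsEdges p M)

hamPaths⇒extends-∷ : ∀ {n} → HamPathsThroughMatchings n → (a b : Vertex n) {M : EdgeList n} →
                     Adjacent a b → ¬ Covered a M → IsMatching M → ExtendsToHamCycle ((a , b) ∷ M)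
hamPaths⇒extends-∷ paths a b {M} ab a∉M matching
  with p , ham , hd , lt , contains ← paths M matching a b (adjacent⇒oppositeParity a b ab) a∉M
  = hamPath-extends ham hd lt ab contains

mainTheorem13 :
    (∀ (n : ℕ) → 2 ≤ n → (M : EdgeList n) → IsMatching M →
      (u v : Vertex n) → OppositeParity u v → ¬ Covered u M →
      Σ (List (Vertex n)) (λ p → IsHamPath p × head p ≡ just u × last p ≡ just v × ContainsEdges p M)) →
    ∀ (n : ℕ) → 2 ≤ n → (M : EdgeList n) → IsMatching M → ExtendsToHamCycle M
mainTheorem13 paths (suc n) 2≤n [] matching =
  ExtendsToHamCycle-tail (hamPaths⇒extends-∷ (paths (suc n) 2≤n) 0ⁿ e₁ (zero-adjacent-e₁ n) (λ ()) matching)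
  where
  0ⁿ e₁ : Vertex (suc n)
  0ⁿ = replicate (suc n) false
  e₁ = true ∷ᵥ replicate n false
mainTheorem13 paths n 2≤n ((a , b) ∷ M) matching with ab , a∉M , matching′ ← matching-uncons matching =
  hamPaths⇒extends-∷ (paths n 2≤n) a b ab a∉M matching′
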